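{- Let $n\ge 2$, $k\ge 1$ and let $m$ be an integer with $\max\{k,2\}\le m\le \lfloor n/2\rfloor$. Then $K^k_{n-m,m}\prec K^k_{n-1,1}$.
   Context: For a simple graph $G$, $m(G,t)$ denotes the number of $t$-matchings of $G$, with $m(G,0)=1$. For graphs $G_1,G_2$ of order $n$, $G_1\preceq G_2$ means $m(G_1,t)\le m(G_2,t)$ for all $t=0,1,\dots,\lfloor n/2\rfloor$; $G_1\prec G_2$ means $G_1\preceq G_2$ and $m(G_1,i)<m(G_2,i)$ for some $i$. For $k\le m\le\lfloor n/2\rfloor$, $K^k_{n-m,m}$ is the graph obtained from the disjoint union $K_{n-m}\cup K_m$ by adding $k$ pairwise independent (vertex-disjoint) edges each joining a vertex of $K_{n-m}$ to a vertex of $K_m$. $K^k_{n-1,1}$ is the graph obtained from $K_1\cup K_{n-1}$ by adding $k$ edges between the vertex of $K_1$ and $k$ distinct vertices of $K_{n-1}$. -}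

module Defs where

open import Data.Bool using (Bool; true; false; _∧_; _∨_; not; if_then_else_)
open import Data.Nat using (ℕ; zero; suc; _+_; _≤_; _<_; _<ᵇ_; _≡ᵇ_; _/_)
open import Data.Product using (_×_; _,_; Σ; ∃)
open import Data.List using (List; []; _∷_; upTo; concatMap; filter; any; map)

-- A simple graph of order n: vertex set {0,…,n-1} (as naturals) and an
-- adjacency test.  Only pairs i < j < n are consulted, so the graph is
-- automatically simple (loopless, undirected, no multi-edges).
record Graph : Set where
  constructor graph
  field
    order : ℕ
    adj   : ℕ → ℕ → Bool
open Graph public

edges : Graph → List (ℕ × ℕ)
edges G = concatMap (λ j → concatMap (λ i → if adj G i j then (i , j) ∷ [] else []) (upTo j))
                    (upTo (order G))

elemᵇ : ℕ → List ℕ → Bool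
elemᵇ x []       = false
elemᵇ x (y ∷ ys) = (x ≡ᵇ y) ∨ elemᵇ x ys

-- number of ways to pick t edges from the list, pairwise vertex-disjoint
-- and disjoint from the already used vertices
countMatch : List (ℕ × ℕ) → List ℕ → ℕ → ℕ
countMatch []             used zero    = 1
countMatch []             used (suc t) = 0
countMatch ((i , j) ∷ es) used zero    = countMatch es used zero
countMatch ((i , j) ∷ es) used (suc t) =
  countMatch es used (suc t)
  + (if elemᵇ i used ∨ elemᵇ j used then 0 else countMatch es (i ∷ j ∷ used) t)

mt : Graph → ℕ → ℕ
mt G t = countMatch (edges G) [] t

_⪯_ : Graph → Graph → Set
G₁ ⪯ G₂ = ∀ t → t ≤ order G₁ / 2 → mt G₁ t ≤ mt G₂ t

_≺_ : Graph → Graph → Set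
G₁ ≺ G₂ = (G₁ ⪯ G₂) × ∃ (λ i → i ≤ order G₁ / 2 × mt G₁ i < mt G₂ i)

-- K^k_{n-m,m}: K_m on {0,…,m-1}, K_{n-m} on {m,…,n-1}, plus the k
-- independent edges {i , m+i} for i < k.   (called with i < j)
Kkm : ℕ → ℕ → ℕ → Graph
Kkm n m k = graph n (λ i j → (j <ᵇ m) ∨ ((not (i <ᵇ m)) ∨ ((i <ᵇ k) ∧ (j ≡ᵇ (m + i)))))

-- K^k_{n-1,1}: K_1 = {0}, K_{n-1} on {1,…,n-1}, plus edges {0 , j} for 1 ≤ j ≤ k.
Kstar : ℕ → ℕ → Graph
Kstar n k = graph n (λ i j → not (i ≡ᵇ 0) ∨ (j <ᵇ suc k))

module Submission where

-- Adding a vertex n to a graph splits the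
-- matchings by the edge covering n; for the union of two cliques this yields
-- the closed recursion mUnion (and mK for a single clique K_a).
-- A numerical induction shows m(K_a ∪ K_b + bridge, t) ≤ m(K_(a+b-1) +
-- pendant edge, t), strictly for t = 1; this is the case k = 1.
-- Adding the next bridge {k , m+k} to K^k_{n-m,m}, resp. the edge {0 , k+1}
-- to K^k_{n-1,1}, adds the (t-1)-matchings avoiding its two ends.  The first
-- term is at most m(K_(n-2), t-1); the second is at least that, since
-- K^k_{n-1,1} minus vertex 0 is complete.

open import Defs
open import Data.Bool using (Bool; true; false; _∧_; _∨_; not; if_then_else_)
open import Data.Bool.Properties using (∨-commutativeMonoid; ∨-identityʳ; ∧-zeroʳ; T-≡; ¬-not)
open import Algebra.Solver.CommutativeMonoid ∨-commutativeMonoid using (solve; _⊕_; _⊜_)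
open import Data.Empty using (⊥-elim)
open import Data.List using (List; []; _∷_; upTo; concatMap; _++_)
open import Data.List.Relation.Unary.All using (All; []; _∷_)
open import Data.List.Properties using (upTo-∷ʳ; ++-identityʳ; concatMap-cong; concatMap-++)
open import Data.Nat using (ℕ; zero; suc; _+_; _*_; _∸_; _≤_; _<_; _/_; _<ᵇ_; _≡ᵇ_; z≤n; s≤s; pred)
open import Data.Nat.DivMod using (m/n*n≤m)
open import Data.Nat.Properties
open import Data.Nat.Tactic.RingSolver using (solve-∀)
open import Data.Product using (_×_; _,_; proj₁; proj₂)
open import Data.Sum using (_⊎_; inj₁; inj₂)
open import Function using (_∘_)
open import Function.Bundles using (Equivalence)
open import Relation.Binary.Definitions using (tri<; tri≈; tri>)
open import Relation.Binary.PropositionalEquality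
open import Relation.Nullary using (yes; no)
open Equivalence using (to; from)

bool-cases : ∀ b → b ≡ true ⊎ b ≡ false
bool-cases true  = inj₁ refl
bool-cases false = inj₂ refl

∨-true : ∀ a b → a ∨ b ≡ true → a ≡ true ⊎ b ≡ true
∨-true true  b _ = inj₁ refl
∨-true false b e = inj₂ e

∨-trueˡ : ∀ a b → a ≡ true → a ∨ b ≡ true
∨-trueˡ .true b refl = refl

∨-trueʳ : ∀ a b → b ≡ true → a ∨ b ≡ true
∨-trueʳ true  b _ = refl
∨-trueʳ false b e = e

≡ᵇ-refl : ∀ n → (n ≡ᵇ n) ≡ true
≡ᵇ-refl n = to T-≡ (≡⇒≡ᵇ n n refl)

≡ᵇ-sym : ∀ x y → (x ≡ᵇ y) ≡ (y ≡ᵇ x)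
≡ᵇ-sym zero    zero    = refl
≡ᵇ-sym zero    (suc y) = refl
≡ᵇ-sym (suc x) zero    = refl
≡ᵇ-sym (suc x) (suc y) = ≡ᵇ-sym x y

≡ᵇ-false : ∀ {x y} → x ≢ y → (x ≡ᵇ y) ≡ false
≡ᵇ-false {x} {y} x≢y = ¬-not (λ eq → x≢y (≡ᵇ⇒≡ x y (from T-≡ eq)))

<ᵇ-true : ∀ {a b} → a < b → (a <ᵇ b) ≡ true
<ᵇ-true a<b = to T-≡ (<⇒<ᵇ a<b)

<ᵇ-false : ∀ {a b} → b ≤ a → (a <ᵇ b) ≡ false
<ᵇ-false {a} {b} b≤a = ¬-not (λ lt → <⇒≱ (<ᵇ⇒< a b (from T-≡ lt)) b≤a)

<ᵇ-suc : ∀ {i k} → i ≢ k → (i <ᵇ suc k) ≡ (i <ᵇ k)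
<ᵇ-suc {zero}  {zero}  i≢k = ⊥-elim (i≢k refl)
<ᵇ-suc {zero}  {suc k} i≢k = refl
<ᵇ-suc {suc i} {zero}  i≢k = refl
<ᵇ-suc {suc i} {suc k} i≢k = <ᵇ-suc {i} {k} (λ i≡k → i≢k (cong suc i≡k))

touches : List ℕ → ℕ × ℕ → Bool
touches u (i , j) = elemᵇ i u ∨ elemᵇ j u

Touches : List ℕ → ℕ × ℕ → Set
Touches u e = touches u e ≡ true

_⊑_ : List ℕ → List ℕ → Set
u ⊑ u' = ∀ x → elemᵇ x u ≡ true → elemᵇ x u' ≡ true

⊑-nil : ∀ u → [] ⊑ u
⊑-nil u x ()

⊑-extend : ∀ i j u → u ⊑ (i ∷ j ∷ u)
⊑-extend i j u x e = ∨-trueʳ (x ≡ᵇ i) _ (∨-trueʳ (x ≡ᵇ j) _ e)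

⊑-cons : ∀ i j {u u'} → u ⊑ u' → (i ∷ j ∷ u) ⊑ (i ∷ j ∷ u')
⊑-cons i j {u' = u'} s x e with ∨-true (x ≡ᵇ i) _ e
... | inj₁ xi = ∨-trueˡ _ _ xi
... | inj₂ e' with ∨-true (x ≡ᵇ j) _ e'
...   | inj₁ xj = ∨-trueʳ (x ≡ᵇ i) _ (∨-trueˡ _ _ xj)
...   | inj₂ xu = ∨-trueʳ (x ≡ᵇ i) _ (∨-trueʳ (x ≡ᵇ j) (elemᵇ x u') (s x xu))

touches-⊑ : ∀ {u u'} e → u ⊑ u' → Touches u e → Touches u' e
touches-⊑ {u} {u'} (i , j) s e with ∨-true (elemᵇ i u) (elemᵇ j u) e
... | inj₁ ei = ∨-trueˡ (elemᵇ i u') (elemᵇ j u') (s i ei)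
... | inj₂ ej = ∨-trueʳ (elemᵇ i u') (elemᵇ j u') (s j ej)

skipIf : Bool → ℕ → ℕ
skipIf b x = if b then 0 else x

skipIf-true : ∀ {b x} → b ≡ true → skipIf b x ≡ 0
skipIf-true refl = refl

skipIf-mono : ∀ b {x y} → x ≤ y → skipIf b x ≤ skipIf b y
skipIf-mono true  _   = z≤n
skipIf-mono false x≤y = x≤y

skipIf-∨ : ∀ a b x → skipIf (a ∨ b) x ≡ skipIf a (skipIf b x)
skipIf-∨ true  b x = refl
skipIf-∨ false b x = refl

skipIf-+ : ∀ a x y → skipIf a (x + y) ≡ skipIf a x + skipIf a y
skipIf-+ true  x y = refl
skipIf-+ false x y = refl

countMatch-zero : ∀ es u → countMatch es u 0 ≡ 1
countMatch-zero []            u = refl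
countMatch-zero ((i , j) ∷ es) u = countMatch-zero es u

countMatch-antitone : ∀ es u u' → u ⊑ u' → ∀ t → countMatch es u' t ≤ countMatch es u t
countMatch-antitone []             u u' s zero    = ≤-refl
countMatch-antitone []             u u' s (suc t) = ≤-refl
countMatch-antitone ((i , j) ∷ es) u u' s zero    = countMatch-antitone es u u' s zero
countMatch-antitone ((i , j) ∷ es) u u' s (suc t) with touches u (i , j) in touched
... | true  = subst (λ v → countMatch es u' (suc t) + v ≤ countMatch es u (suc t) + 0)
                   (sym (skipIf-true (touches-⊑ {u} {u'} (i , j) s touched)))
                   (+-monoˡ-≤ 0 (countMatch-antitone es u u' s (suc t)))
... | false = +-mono-≤ (countMatch-antitone es u u' s (suc t)) (residual (touches u' (i , j)))
  where
  residual : ∀ b → skipIf b (countMatch es (i ∷ j ∷ u') t) ≤ countMatch es (i ∷ j ∷ u) t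
  residual true  = z≤n
  residual false = countMatch-antitone es (i ∷ j ∷ u) (i ∷ j ∷ u') (⊑-cons i j {u} {u'} s) t

countMatch-ext : ∀ es {u u'} → (∀ x → elemᵇ x u ≡ elemᵇ x u') → ∀ t
  → countMatch es u t ≡ countMatch es u' t
countMatch-ext es {u} {u'} h t =
  ≤-antisym (countMatch-antitone es u' u (λ x e → trans (h x) e) t)
            (countMatch-antitone es u u' (λ x e → trans (sym (h x)) e) t)

-- Using e and then f blocks exactly what using f and then e blocks.
touches-exchange : ∀ a b c d u →
  touches u (a , b) ∨ touches (a ∷ b ∷ u) (c , d) ≡ touches u (c , d) ∨ touches (c ∷ d ∷ u) (a , b)
touches-exchange a b c d u
  rewrite ≡ᵇ-sym c a | ≡ᵇ-sym c b | ≡ᵇ-sym d a | ≡ᵇ-sym d b =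
  solve 8 (λ ea eb ec ed ac ad bc bd →
      (ea ⊕ eb) ⊕ ((ac ⊕ (bc ⊕ ec)) ⊕ (ad ⊕ (bd ⊕ ed)))
    ⊜ (ec ⊕ ed) ⊕ ((ac ⊕ (ad ⊕ ea)) ⊕ (bc ⊕ (bd ⊕ eb))))
    refl (elemᵇ a u) (elemᵇ b u) (elemᵇ c u) (elemᵇ d u) (a ≡ᵇ c) (a ≡ᵇ d) (b ≡ᵇ c) (b ≡ᵇ d)

+-exchange : ∀ x y z w → (x + y) + (z + w) ≡ (x + z) + (y + w)
+-exchange = solve-∀

countMatch-swap : ∀ e f es u t → countMatch (e ∷ f ∷ es) u t ≡ countMatch (f ∷ e ∷ es) u t
countMatch-swap e f es u zero = refl
countMatch-swap (a , b) (c , d) es u (suc zero) =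
  trans (+-assoc (countMatch es u 1) _ _)
  (trans (cong (countMatch es u 1 +_) (+-comm (skipIf (touches u (c , d)) _) (skipIf (touches u (a , b)) _)))
         (sym (+-assoc (countMatch es u 1) _ _)))
countMatch-swap (a , b) (c , d) es u (suc (suc t)) = begin
    (X + skipIf Tf Y) + skipIf Te (Z + skipIf Tf' W)
      ≡⟨ cong ((X + skipIf Tf Y) +_) (skipIf-+ Te Z _) ⟩
    (X + skipIf Tf Y) + (skipIf Te Z + skipIf Te (skipIf Tf' W))
      ≡⟨ cong (λ v → (X + skipIf Tf Y) + (skipIf Te Z + v)) both ⟩
    (X + skipIf Tf Y) + (skipIf Te Z + skipIf Tf (skipIf Te' W'))
      ≡⟨ +-exchange X (skipIf Tf Y) (skipIf Te Z) _ ⟩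
    (X + skipIf Te Z) + (skipIf Tf Y + skipIf Tf (skipIf Te' W'))
      ≡⟨ cong ((X + skipIf Te Z) +_) (sym (skipIf-+ Tf Y _)) ⟩
    (X + skipIf Te Z) + skipIf Tf (Y + skipIf Te' W') ∎
  where
  open ≡-Reasoning
  X  = countMatch es u (suc (suc t))
  Y  = countMatch es (c ∷ d ∷ u) (suc t)
  Z  = countMatch es (a ∷ b ∷ u) (suc t)
  W  = countMatch es (c ∷ d ∷ a ∷ b ∷ u) t
  W' = countMatch es (a ∷ b ∷ c ∷ d ∷ u) t
  Te  = touches u (a , b)
  Tf  = touches u (c , d)
  Te' = touches (c ∷ d ∷ u) (a , b)
  Tf' = touches (a ∷ b ∷ u) (c , d)
  W≡W' : W ≡ W'
  W≡W' = countMatch-ext es (λ x → solve 5 (λ xc xd xa xb xu →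
      xc ⊕ (xd ⊕ (xa ⊕ (xb ⊕ xu))) ⊜ xa ⊕ (xb ⊕ (xc ⊕ (xd ⊕ xu))))
    refl (x ≡ᵇ c) (x ≡ᵇ d) (x ≡ᵇ a) (x ≡ᵇ b) (elemᵇ x u)) t
  both : skipIf Te (skipIf Tf' W) ≡ skipIf Tf (skipIf Te' W')
  both = begin
    skipIf Te (skipIf Tf' W) ≡⟨ sym (skipIf-∨ Te Tf' W) ⟩
    skipIf (Te ∨ Tf') W      ≡⟨ cong₂ skipIf (touches-exchange a b c d u) W≡W' ⟩
    skipIf (Tf ∨ Te') W'     ≡⟨ skipIf-∨ Tf Te' W' ⟩
    skipIf Tf (skipIf Te' W') ∎

data Insertion (e : ℕ × ℕ) : List (ℕ × ℕ) → List (ℕ × ℕ) → Set where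
  here  : ∀ {xs} → Insertion e xs (e ∷ xs)
  there : ∀ {x xs ys} → Insertion e xs ys → Insertion e (x ∷ xs) (x ∷ ys)

Insertion-++ʳ : ∀ {e xs ys} zs → Insertion e xs ys → Insertion e (xs ++ zs) (ys ++ zs)
Insertion-++ʳ zs here      = here
Insertion-++ʳ zs (there p) = there (Insertion-++ʳ zs p)

Insertion-++ˡ : ∀ {e xs ys} zs → Insertion e xs ys → Insertion e (zs ++ xs) (zs ++ ys)
Insertion-++ˡ []       p = p
Insertion-++ˡ (z ∷ zs) p = there (Insertion-++ˡ zs p)

countMatch-cons-cong : ∀ e {xs ys} → (∀ u t → countMatch xs u t ≡ countMatch ys u t)
  → ∀ u t → countMatch (e ∷ xs) u t ≡ countMatch (e ∷ ys) u t
countMatch-cons-cong (i , j) h u zero    = h u zero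
countMatch-cons-cong (i , j) h u (suc t) =
  cong₂ _+_ (h u (suc t)) (cong (skipIf _) (h (i ∷ j ∷ u) t))

countMatch-insertion : ∀ {e xs ys} → Insertion e xs ys
  → ∀ u t → countMatch ys u t ≡ countMatch (e ∷ xs) u t
countMatch-insertion here u t = refl
countMatch-insertion {e} (there {x} {xs} p) u t =
  trans (countMatch-cons-cong x (countMatch-insertion p) u t) (countMatch-swap x e xs u t)

-- Embeds u xs ys: ys arises from xs by inserting arbitrary edges and by
-- deleting edges that touch u.  Such edges never occur in a matching avoiding
-- u, so every matching of xs avoiding u is one of ys.
data Embeds (u : List ℕ) : List (ℕ × ℕ) → List (ℕ × ℕ) → Set where
  done  : Embeds u [] []
  keep  : ∀ e {xs ys} → Embeds u xs ys → Embeds u (e ∷ xs) (e ∷ ys)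
  add   : ∀ e {xs ys} → Embeds u xs ys → Embeds u xs (e ∷ ys)
  drop  : ∀ e {xs ys} → Touches u e → Embeds u xs ys → Embeds u (e ∷ xs) ys

Embeds-⊑ : ∀ {u u' xs ys} → u ⊑ u' → Embeds u xs ys → Embeds u' xs ys
Embeds-⊑ s done          = done
Embeds-⊑ s (keep e p)    = keep e (Embeds-⊑ s p)
Embeds-⊑ s (add e p)     = add e (Embeds-⊑ s p)
Embeds-⊑ {u} {u'} s (drop e touched p) = drop e (touches-⊑ {u} {u'} e s touched) (Embeds-⊑ s p)

Embeds-++ : ∀ {u a a' b b'} → Embeds u a a' → Embeds u b b' → Embeds u (a ++ b) (a' ++ b')
Embeds-++ done               q = q
Embeds-++ (keep e p)         q = keep e (Embeds-++ p q)
Embeds-++ (add e p)          q = add e (Embeds-++ p q)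
Embeds-++ (drop e touched p) q = drop e touched (Embeds-++ p q)

countMatch-cons-≤ : ∀ e es u t → countMatch es u t ≤ countMatch (e ∷ es) u t
countMatch-cons-≤ (i , j) es u zero    = ≤-refl
countMatch-cons-≤ (i , j) es u (suc t) = m≤m+n _ _

countMatch-embeds : ∀ {u xs ys} → Embeds u xs ys → ∀ t → countMatch xs u t ≤ countMatch ys u t
countMatch-embeds done       zero    = ≤-refl
countMatch-embeds done       (suc t) = ≤-refl
countMatch-embeds (keep e p) zero    = countMatch-embeds p zero
countMatch-embeds {u} (keep (i , j) p) (suc t) =
  +-mono-≤ (countMatch-embeds p (suc t))
           (skipIf-mono (touches u (i , j)) (countMatch-embeds (Embeds-⊑ (⊑-extend i j u) p) t))
countMatch-embeds {u} (add e {ys = ys} p) t =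
  ≤-trans (countMatch-embeds p t) (countMatch-cons-≤ e ys u t)
countMatch-embeds (drop e touched p) zero = countMatch-embeds p zero
countMatch-embeds {u} (drop (i , j) {xs} {ys} touched p) (suc t) = begin
  countMatch xs u (suc t) + skipIf (touches u (i , j)) _ ≡⟨ cong (_ +_) (skipIf-true touched) ⟩
  countMatch xs u (suc t) + 0                             ≡⟨ +-identityʳ _ ⟩
  countMatch xs u (suc t)                                 ≤⟨ countMatch-embeds p (suc t) ⟩
  countMatch ys u (suc t)                                 ∎
  where open ≤-Reasoning

countMatch-++-touching : ∀ xs {rs} u → All (Touches u) rs
  → ∀ t → countMatch (xs ++ rs) u t ≡ countMatch xs u t
countMatch-++-touching xs {rs} u all t =
  ≤-antisym (countMatch-embeds (dropAll xs) t) (countMatch-embeds (addAll xs) t)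
  where
  dropAll : ∀ xs → Embeds u (xs ++ rs) xs
  dropAll []       = dropEach all
    where
    dropEach : ∀ {rs'} → All (Touches u) rs' → Embeds u rs' []
    dropEach []                 = done
    dropEach (touched ∷ rest)  = drop _ touched (dropEach rest)
  dropAll (x ∷ xs) = keep x (dropAll xs)
  addAll : ∀ xs → Embeds u xs (xs ++ rs)
  addAll []       = addEach rs
    where
    addEach : ∀ rs' → Embeds u [] rs'
    addEach []        = done
    addEach (r ∷ rs') = add r (addEach rs')
  addAll (x ∷ xs) = keep x (addAll xs)

Fan : ℕ → List (ℕ × ℕ) → Set
Fan n = All (λ e → proj₂ e ≡ n)

-- Count of matchings of xs ++ rs using one (necessarily the last) edge of rs.
fanCount : List (ℕ × ℕ) → List ℕ → ℕ → List (ℕ × ℕ) → ℕ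
fanCount xs u t []             = 0
fanCount xs u t ((i , j) ∷ rs) =
  skipIf (touches u (i , j)) (countMatch xs (i ∷ j ∷ u) t) + fanCount xs u t rs

fanCount-++ : ∀ xs u t as bs → fanCount xs u t (as ++ bs) ≡ fanCount xs u t as + fanCount xs u t bs
fanCount-++ xs u t []             bs = refl
fanCount-++ xs u t ((i , j) ∷ as) bs =
  trans (cong (e₁ +_) (fanCount-++ xs u t as bs)) (sym (+-assoc e₁ (fanCount xs u t as) _))
  where e₁ = skipIf (touches u (i , j)) (countMatch xs (i ∷ j ∷ u) t)

Fan-++ : ∀ {n as bs} → Fan n as → Fan n bs → Fan n (as ++ bs)
Fan-++ []          bs = bs
Fan-++ (e≡n ∷ as) bs = e≡n ∷ Fan-++ as bs

fan-blocked : ∀ {n rs} i u → Fan n rs → All (Touches (i ∷ n ∷ u)) rs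
fan-blocked i u [] = []
fan-blocked {n} i u (_∷_ {i' , .n} refl fan) =
  ∨-trueʳ (elemᵇ i' (i ∷ n ∷ u)) _ (∨-trueʳ (n ≡ᵇ i) _ (∨-trueˡ (n ≡ᵇ n) _ (≡ᵇ-refl n)))
  ∷ fan-blocked i u fan

-- A matching of xs ++ rs uses at most one edge of the fan rs.
countMatch-fan : ∀ xs u t {n rs} → Fan n rs
  → countMatch (xs ++ rs) u (suc t) ≡ countMatch xs u (suc t) + fanCount xs u t rs
countMatch-fan xs u t [] =
  trans (cong (λ ys → countMatch ys u (suc t)) (++-identityʳ xs)) (sym (+-identityʳ _))
countMatch-fan xs u t {n} (_∷_ {i , .n} {rs} refl fan) = begin
  countMatch (xs ++ (i , n) ∷ rs) u (suc t)
    ≡⟨ countMatch-insertion (Insertion-++ˡ xs here) u (suc t) ⟩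
  countMatch (xs ++ rs) u (suc t) + skipIf B (countMatch (xs ++ rs) (i ∷ n ∷ u) t)
    ≡⟨ cong₂ _+_ (countMatch-fan xs u t fan)
                 (cong (skipIf B) (countMatch-++-touching xs (i ∷ n ∷ u) (fan-blocked i u fan) t)) ⟩
  (countMatch xs u (suc t) + fanCount xs u t rs) + skipIf B (countMatch xs (i ∷ n ∷ u) t)
    ≡⟨ +-assoc (countMatch xs u (suc t)) _ _ ⟩
  countMatch xs u (suc t) + (fanCount xs u t rs + skipIf B (countMatch xs (i ∷ n ∷ u) t))
    ≡⟨ cong (countMatch xs u (suc t) +_) (+-comm (fanCount xs u t rs) _) ⟩
  countMatch xs u (suc t) + fanCount xs u t ((i , n) ∷ rs) ∎
  where
  open ≡-Reasoning
  B = touches u (i , n)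

-- Edge lists of graphs.  Defs.edges lists a graph column by column: column j
-- holds the edges (i , j) with i < j, in increasing order of i.

Adjacency : Set
Adjacency = ℕ → ℕ → Bool

edgesOf : Adjacency → ℕ → List (ℕ × ℕ)
edgesOf adj n = edges (graph n adj)

entry : Adjacency → ℕ → ℕ → List (ℕ × ℕ)
entry adj j i = if adj i j then (i , j) ∷ [] else []

concatUpTo : (ℕ → List (ℕ × ℕ)) → ℕ → List (ℕ × ℕ)
concatUpTo h x = concatMap h (upTo x)

column : Adjacency → ℕ → List (ℕ × ℕ)
column adj j = concatUpTo (entry adj j) j

concatUpTo-suc : ∀ h x → concatUpTo h (suc x) ≡ concatUpTo h x ++ h x
concatUpTo-suc h x = begin
  concatMap h (upTo (suc x))              ≡⟨ cong (concatMap h) (sym (upTo-∷ʳ x)) ⟩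
  concatMap h (upTo x ++ x ∷ [])          ≡⟨ concatMap-++ h (upTo x) (x ∷ []) ⟩
  concatMap h (upTo x) ++ (h x ++ [])     ≡⟨ cong (concatMap h (upTo x) ++_) (++-identityʳ (h x)) ⟩
  concatMap h (upTo x) ++ h x             ∎
  where open ≡-Reasoning

edgesOf-suc : ∀ adj n → edgesOf adj (suc n) ≡ edgesOf adj n ++ column adj n
edgesOf-suc adj n = concatUpTo-suc (column adj) n

column-fan : ∀ adj n x → Fan n (concatUpTo (entry adj n) x)
column-fan adj n zero    = []
column-fan adj n (suc x) =
  subst (Fan n) (sym (concatUpTo-suc (entry adj n) x)) (Fan-++ (column-fan adj n x) entry-fan)
  where
  entry-fan : Fan n (entry adj n x)
  entry-fan with adj x n
  ... | true  = refl ∷ []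
  ... | false = []

Embeds-concatUpTo : ∀ {u} h h' x → (∀ y → y < x → Embeds u (h y) (h' y))
  → Embeds u (concatUpTo h x) (concatUpTo h' x)
Embeds-concatUpTo h h' zero    emb = done
Embeds-concatUpTo {u} h h' (suc x) emb =
  subst₂ (Embeds u) (sym (concatUpTo-suc h x)) (sym (concatUpTo-suc h' x))
    (Embeds-++ (Embeds-concatUpTo h h' x (λ y y<x → emb y (m<n⇒m<1+n y<x))) (emb x ≤-refl))

edgesOf-embeds : ∀ u adj adj' n
  → (∀ i j → i < j → j < n → adj i j ≡ true → adj' i j ≡ true ⊎ Touches u (i , j))
  → Embeds u (edgesOf adj n) (edgesOf adj' n)
edgesOf-embeds u adj adj' n hyp =
  Embeds-concatUpTo (column adj) (column adj') n (λ j j<n →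
    Embeds-concatUpTo (entry adj j) (entry adj' j) j (λ i i<j → entry-embeds i j (hyp i j i<j j<n)))
  where
  entry-embeds : ∀ i j → (adj i j ≡ true → adj' i j ≡ true ⊎ Touches u (i , j))
    → Embeds u (entry adj j i) (entry adj' j i)
  entry-embeds i j h with adj i j | adj' i j
  ... | false | false = done
  ... | false | true  = add _ done
  ... | true  | true  = keep _ done
  ... | true  | false with h refl
  ...   | inj₁ ()
  ...   | inj₂ touched = drop _ touched done

concatUpTo-agree : ∀ h h' a → (∀ y → y ≢ a → h y ≡ h' y)
  → ∀ x → x ≤ a → concatUpTo h x ≡ concatUpTo h' x
concatUpTo-agree h h' a agree zero    _    = refl
concatUpTo-agree h h' a agree (suc x) x<a = begin
  concatUpTo h (suc x)      ≡⟨ concatUpTo-suc h x ⟩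
  concatUpTo h x ++ h x     ≡⟨ cong₂ _++_ (concatUpTo-agree h h' a agree x (<⇒≤ x<a))
                                          (agree x (λ x≡a → <-irrefl x≡a x<a)) ⟩
  concatUpTo h' x ++ h' x   ≡⟨ sym (concatUpTo-suc h' x) ⟩
  concatUpTo h' (suc x)     ∎
  where open ≡-Reasoning

Insertion-concatUpTo : ∀ h h' a e → (∀ y → y ≢ a → h y ≡ h' y) → Insertion e (h a) (h' a)
  → ∀ x → a < x → Insertion e (concatUpTo h x) (concatUpTo h' x)
Insertion-concatUpTo h h' a e agree ins (suc x) a<1+x with <-cmp a x
... | tri< a<x _ _ =
  subst₂ (Insertion e) (sym (concatUpTo-suc h x)) (sym (concatUpTo-suc h' x))
    (subst (λ block → Insertion e (concatUpTo h x ++ h x) (concatUpTo h' x ++ block))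
           (agree x (λ x≡a → <-irrefl (sym x≡a) a<x))
           (Insertion-++ʳ (h x) (Insertion-concatUpTo h h' a e agree ins x a<x)))
... | tri≈ _ refl _ =
  subst₂ (Insertion e) (sym (concatUpTo-suc h a)) (sym (concatUpTo-suc h' a))
    (subst (λ prefix → Insertion e (concatUpTo h a ++ h a) (prefix ++ h' a))
           (concatUpTo-agree h h' a agree a ≤-refl)
           (Insertion-++ˡ (concatUpTo h a) ins))
... | tri> _ _ x<a = ⊥-elim (<-irrefl refl (≤-trans a<1+x x<a))

edgesOf-insertion : ∀ adj adj' {a b} n → a < b → b < n
  → (∀ i j → (i ≡ a → j ≢ b) → adj i j ≡ adj' i j) → adj a b ≡ false → adj' a b ≡ true
  → Insertion (a , b) (edgesOf adj n) (edgesOf adj' n)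
edgesOf-insertion adj adj' {a} {b} n a<b b<n agree old new =
  Insertion-concatUpTo (column adj) (column adj') b (a , b) other-columns new-column n b<n
  where
  entry-cong : ∀ i j → adj i j ≡ adj' i j → entry adj j i ≡ entry adj' j i
  entry-cong i j eq = cong (λ x → if x then (i , j) ∷ [] else []) eq
  other-columns : ∀ j → j ≢ b → column adj j ≡ column adj' j
  other-columns j j≢b = concatMap-cong (λ i → entry-cong i j (agree i j (λ _ → j≢b))) (upTo j)
  new-entry : Insertion (a , b) (entry adj b a) (entry adj' b a)
  new-entry rewrite old | new = here
  new-column : Insertion (a , b) (column adj b) (column adj' b)
  new-column = Insertion-concatUpTo (entry adj b) (entry adj' b) a (a , b)
    (λ i i≢a → entry-cong i b (agree i b (λ i≡a → ⊥-elim (i≢a i≡a)))) new-entry b a<b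

countBelow : (ℕ → Bool) → ℕ → ℕ
countBelow P zero    = 0
countBelow P (suc x) = countBelow P x + (if P x then 1 else 0)

countBelow-cong : ∀ {P Q} x → (∀ j → j < x → P j ≡ Q j) → countBelow P x ≡ countBelow Q x
countBelow-cong zero    eq = refl
countBelow-cong (suc x) eq =
  cong₂ (λ c b → c + (if b then 1 else 0))
        (countBelow-cong x (λ j j<x → eq j (m<n⇒m<1+n j<x))) (eq x ≤-refl)

countBelow-none : ∀ {P} x → (∀ j → j < x → P j ≡ false) → countBelow P x ≡ 0
countBelow-none zero    none = refl
countBelow-none (suc x) none rewrite none x ≤-refl =
  trans (+-identityʳ _) (countBelow-none x (λ j j<x → none j (m<n⇒m<1+n j<x)))

isFree : (ℕ → Bool) → List ℕ → ℕ → Bool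
isFree A u j = A j ∧ not (elemᵇ j u)

countFree : (ℕ → Bool) → List ℕ → ℕ → ℕ
countFree A u x = countBelow (isFree A u) x

countFree-ext : ∀ A {u u'} x → (∀ j → j < x → elemᵇ j u ≡ elemᵇ j u')
  → countFree A u x ≡ countFree A u' x
countFree-ext A x same = countBelow-cong x (λ j j<x → cong (λ b → A j ∧ not b) (same j j<x))

countFree-use-beyond : ∀ A i u x → x ≤ i → countFree A (i ∷ u) x ≡ countFree A u x
countFree-use-beyond A i u x x≤i =
  countFree-ext A {i ∷ u} {u} x (λ j j<x →
    cong (_∨ elemᵇ j u) (≡ᵇ-false (λ j≡i → <-irrefl j≡i (<-≤-trans j<x x≤i))))

isFree-after-use : ∀ A i u j → j ≢ i → isFree A (i ∷ u) j ≡ isFree A u j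
isFree-after-use A i u j j≢i rewrite ≡ᵇ-false j≢i = refl

countFree-use-unfree : ∀ A i u x → isFree A u i ≡ false → countFree A (i ∷ u) x ≡ countFree A u x
countFree-use-unfree A i u x unfree = countBelow-cong x same
  where
  same : ∀ j → j < x → isFree A (i ∷ u) j ≡ isFree A u j
  same j _ with j ≟ i
  ... | yes refl rewrite ≡ᵇ-refl i | ∧-zeroʳ (A i) = sym unfree
  ... | no j≢i = isFree-after-use A i u j j≢i

countFree-use-free : ∀ A i u x → i < x → isFree A u i ≡ true
  → suc (countFree A (i ∷ u) x) ≡ countFree A u x
countFree-use-free A i u (suc x) i<1+x free with <-cmp i x
... | tri< i<x _ _ = cong₂ (λ c b → c + (if b then 1 else 0))
                           (countFree-use-free A i u x i<x free)
                           (isFree-after-use A i u x (λ x≡i → <-irrefl (sym x≡i) i<x))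
... | tri≈ _ refl _ rewrite ≡ᵇ-refl i | ∧-zeroʳ (A i) | free =
  trans (cong suc (trans (+-identityʳ _) (countFree-use-beyond A i u i ≤-refl))) (+-comm 1 _)
... | tri> _ _ x<i = ⊥-elim (<-irrefl refl (≤-trans i<1+x x<i))

countFree-forget : ∀ A i n u → countFree A (i ∷ n ∷ u) n ≡ countFree A (i ∷ u) n
countFree-forget A i n u = countFree-ext A {i ∷ n ∷ u} {i ∷ u} n (λ j j<n →
  cong (λ b → (j ≡ᵇ i) ∨ (b ∨ elemᵇ j u)) (≡ᵇ-false (λ j≡n → <-irrefl j≡n j<n)))

freeNeighbour : Adjacency → List ℕ → ℕ → ℕ → Bool
freeNeighbour adj u n i = adj i n ∧ not (touches u (i , n))

fanCount-column : ∀ adj n xs u t V x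
  → (∀ i → i < x → freeNeighbour adj u n i ≡ true → countMatch xs (i ∷ n ∷ u) t ≡ V)
  → fanCount xs u t (concatUpTo (entry adj n) x) ≡ countBelow (freeNeighbour adj u n) x * V
fanCount-column adj n xs u t V zero    _        = refl
fanCount-column adj n xs u t V (suc x) residual = begin
  fanCount xs u t (concatUpTo (entry adj n) (suc x))
    ≡⟨ cong (fanCount xs u t) (concatUpTo-suc (entry adj n) x) ⟩
  fanCount xs u t (concatUpTo (entry adj n) x ++ entry adj n x)
    ≡⟨ fanCount-++ xs u t (concatUpTo (entry adj n) x) (entry adj n x) ⟩
  fanCount xs u t (concatUpTo (entry adj n) x) + fanCount xs u t (entry adj n x)
    ≡⟨ cong₂ _+_ (fanCount-column adj n xs u t V x (λ i i<x → residual i (m<n⇒m<1+n i<x))) last ⟩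
  countBelow Q x * V + (if Q x then 1 else 0) * V
    ≡⟨ sym (*-distribʳ-+ V (countBelow Q x) _) ⟩
  countBelow Q (suc x) * V ∎
  where
  open ≡-Reasoning
  Q = freeNeighbour adj u n
  last : fanCount xs u t (entry adj n x) ≡ (if Q x then 1 else 0) * V
  last with adj x n in adjacent
  ... | false = refl
  ... | true with touches u (x , n) in touched
  ...   | true  = refl
  ...   | false = trans (+-identityʳ _)
                        (trans (residual x ≤-refl (cong₂ (λ a b → a ∧ not b) adjacent touched))
                               (sym (+-identityʳ V)))

countMatch-new-vertex : ∀ adj n u t V
  → (∀ i → i < n → freeNeighbour adj u n i ≡ true → countMatch (edgesOf adj n) (i ∷ n ∷ u) t ≡ V)
  → countMatch (edgesOf adj (suc n)) u (suc t)
    ≡ countMatch (edgesOf adj n) u (suc t) + countBelow (freeNeighbour adj u n) n * V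
countMatch-new-vertex adj n u t V residual = begin
  countMatch (edgesOf adj (suc n)) u (suc t)
    ≡⟨ cong (λ es → countMatch es u (suc t)) (edgesOf-suc adj n) ⟩
  countMatch (edgesOf adj n ++ column adj n) u (suc t)
    ≡⟨ countMatch-fan (edgesOf adj n) u t (column-fan adj n n) ⟩
  countMatch (edgesOf adj n) u (suc t) + fanCount (edgesOf adj n) u t (column adj n)
    ≡⟨ cong (countMatch (edgesOf adj n) u (suc t) +_) (fanCount-column adj n (edgesOf adj n) u t V n residual) ⟩
  countMatch (edgesOf adj n) u (suc t) + countBelow (freeNeighbour adj u n) n * V ∎
  where open ≡-Reasoning

-- mK a t = m(K_a, t): a t-matching of K_(a+1) avoids the last vertex or
-- matches it with one of the other a vertices.
mK : ℕ → ℕ → ℕ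
mK a       zero    = 1
mK zero    (suc t) = 0
mK (suc a) (suc t) = mK a (suc t) + a * mK (pred a) t

-- mUnion a b t = m(K_a ∪ K_b, t), by the same recursion in the second clique.
mUnion : ℕ → ℕ → ℕ → ℕ
mUnion a zero    t       = mK a t
mUnion a (suc b) zero    = 1
mUnion a (suc b) (suc t) = mUnion a b (suc t) + b * mUnion a (pred b) t

mUnion-zero : ∀ a b → mUnion a b 0 ≡ 1
mUnion-zero a zero    = refl
mUnion-zero a (suc b) = refl

-- K_m on {0,…,m-1} together with the complete graph on {m, m+1, …};
-- on n ≤ m vertices it is the complete graph K_n.
twoCliques : ℕ → Adjacency
twoCliques m i j = (j <ᵇ m) ∨ not (i <ᵇ m)

-- The matchings of twoCliques m on n vertices avoiding u are those of
-- K_a ∪ K_b, where a and b count the unused vertices below n on either side.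
module TwoCliques (m : ℕ) where

  low high : List ℕ → ℕ → ℕ
  low  = countFree (λ j → j <ᵇ m)
  high = countFree (λ j → not (j <ᵇ m))

  E : ℕ → List (ℕ × ℕ)
  E = edgesOf (twoCliques m)

  TwoCliqueCount : ℕ → Set
  TwoCliqueCount n = ∀ u t → countMatch (E n) u t ≡ mUnion (low u n) (high u n) t

  step-used : ∀ n u t → TwoCliqueCount n → elemᵇ n u ≡ true
    → countMatch (E (suc n)) u (suc t) ≡ mUnion (low u (suc n)) (high u (suc n)) (suc t)
  step-used n u t ih used = begin
    countMatch (E (suc n)) u (suc t)
      ≡⟨ countMatch-new-vertex (twoCliques m) n u t 0 none ⟩
    countMatch (E n) u (suc t) + countBelow (freeNeighbour (twoCliques m) u n) n * 0
      ≡⟨ trans (cong (countMatch (E n) u (suc t) +_) (*-zeroʳ (countBelow _ n)))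
               (+-identityʳ _) ⟩
    countMatch (E n) u (suc t)
      ≡⟨ ih u (suc t) ⟩
    mUnion (low u n) (high u n) (suc t)
      ≡⟨ cong₂ (λ a b → mUnion a b (suc t)) (sym (unchanged (λ j → j <ᵇ m))) (sym (unchanged _)) ⟩
    mUnion (low u (suc n)) (high u (suc n)) (suc t) ∎
    where
    open ≡-Reasoning
    none : ∀ i → i < n → freeNeighbour (twoCliques m) u n i ≡ true
      → countMatch (E n) (i ∷ n ∷ u) t ≡ 0
    none i _ free with () ← trans (sym (∧-zeroʳ (twoCliques m i n)))
      (subst (λ b → twoCliques m i n ∧ not b ≡ true) (∨-trueʳ (elemᵇ i u) _ used) free)
    unchanged : ∀ A → countFree A u (suc n) ≡ countFree A u n
    unchanged A rewrite used | ∧-zeroʳ (A n) = +-identityʳ _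

  high-empty : ∀ {n} u → n ≤ m → high u n ≡ 0
  high-empty {n} u n≤m = countBelow-none n (λ j j<n →
    cong (λ b → not b ∧ not (elemᵇ j u)) (<ᵇ-true (<-≤-trans j<n n≤m)))

  step-low : ∀ n u t → TwoCliqueCount n → n < m → elemᵇ n u ≡ false
    → countMatch (E (suc n)) u (suc t) ≡ mUnion (low u (suc n)) (high u (suc n)) (suc t)
  step-low n u t ih n<m unused = begin
    countMatch (E (suc n)) u (suc t)
      ≡⟨ countMatch-new-vertex (twoCliques m) n u t (mK (pred A) t) residual ⟩
    countMatch (E n) u (suc t) + countBelow Q n * mK (pred A) t
      ≡⟨ cong₂ (λ x y → x + y * mK (pred A) t) (ih u (suc t)) (countBelow-cong n neighbour) ⟩
    mUnion A (high u n) (suc t) + A * mK (pred A) t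
      ≡⟨ cong (λ b → mUnion A b (suc t) + A * mK (pred A) t) (high-empty u (<⇒≤ n<m)) ⟩
    mK (suc A) (suc t)
      ≡⟨ cong₂ (λ a b → mUnion a b (suc t)) (sym low-suc) (sym (high-empty u n<m)) ⟩
    mUnion (low u (suc n)) (high u (suc n)) (suc t) ∎
    where
    open ≡-Reasoning
    A = low u n
    Q = freeNeighbour (twoCliques m) u n
    neighbour : ∀ j → j < n → Q j ≡ isFree (λ j → j <ᵇ m) u j
    neighbour j j<n rewrite <ᵇ-true n<m | unused | <ᵇ-true (<-trans j<n n<m) | ∨-identityʳ (elemᵇ j u) = refl
    low-suc : low u (suc n) ≡ suc A
    low-suc rewrite <ᵇ-true n<m | unused = +-comm A 1
    residual : ∀ i → i < n → Q i ≡ true → countMatch (E n) (i ∷ n ∷ u) t ≡ mK (pred A) t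
    residual i i<n free = begin
      countMatch (E n) (i ∷ n ∷ u) t                   ≡⟨ ih (i ∷ n ∷ u) t ⟩
      mUnion (low (i ∷ n ∷ u) n) (high (i ∷ n ∷ u) n) t
        ≡⟨ cong₂ (λ a b → mUnion a b t) low-res (high-empty (i ∷ n ∷ u) (<⇒≤ n<m)) ⟩
      mK (pred A) t                                      ∎
      where
      low-res : low (i ∷ n ∷ u) n ≡ pred A
      low-res = trans (countFree-forget _ i n u)
        (cong pred (countFree-use-free _ i u n i<n (trans (sym (neighbour i i<n)) free)))

  step-high : ∀ n u t → TwoCliqueCount n → m ≤ n → elemᵇ n u ≡ false
    → countMatch (E (suc n)) u (suc t) ≡ mUnion (low u (suc n)) (high u (suc n)) (suc t)
  step-high n u t ih m≤n unused = begin
    countMatch (E (suc n)) u (suc t)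
      ≡⟨ countMatch-new-vertex (twoCliques m) n u t (mUnion A (pred B) t) residual ⟩
    countMatch (E n) u (suc t) + countBelow Q n * mUnion A (pred B) t
      ≡⟨ cong₂ (λ x y → x + y * mUnion A (pred B) t) (ih u (suc t)) (countBelow-cong n neighbour) ⟩
    mUnion A (suc B) (suc t)
      ≡⟨ cong₂ (λ a b → mUnion a b (suc t)) (sym low-suc) (sym high-suc) ⟩
    mUnion (low u (suc n)) (high u (suc n)) (suc t) ∎
    where
    open ≡-Reasoning
    A = low u n
    B = high u n
    Q = freeNeighbour (twoCliques m) u n
    neighbour : ∀ j → j < n → Q j ≡ isFree (λ j → not (j <ᵇ m)) u j
    neighbour j j<n rewrite <ᵇ-false m≤n | unused | ∨-identityʳ (elemᵇ j u) = refl
    low-suc : low u (suc n) ≡ A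
    low-suc rewrite <ᵇ-false m≤n = +-identityʳ A
    high-suc : high u (suc n) ≡ suc B
    high-suc rewrite <ᵇ-false m≤n | unused = +-comm B 1
    not-low : ∀ a b → not a ∧ b ≡ true → a ∧ b ≡ false
    not-low false b _ = refl
    residual : ∀ i → i < n → Q i ≡ true → countMatch (E n) (i ∷ n ∷ u) t ≡ mUnion A (pred B) t
    residual i i<n free = begin
      countMatch (E n) (i ∷ n ∷ u) t                   ≡⟨ ih (i ∷ n ∷ u) t ⟩
      mUnion (low (i ∷ n ∷ u) n) (high (i ∷ n ∷ u) n) t ≡⟨ cong₂ (λ a b → mUnion a b t) low-res high-res ⟩
      mUnion A (pred B) t                                ∎
      where
      free-high : isFree (λ j → not (j <ᵇ m)) u i ≡ true
      free-high = trans (sym (neighbour i i<n)) free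
      low-res : low (i ∷ n ∷ u) n ≡ A
      low-res = trans (countFree-forget _ i n u)
        (countFree-use-unfree _ i u n (not-low (i <ᵇ m) _ free-high))
      high-res : high (i ∷ n ∷ u) n ≡ pred B
      high-res = trans (countFree-forget _ i n u) (cong pred (countFree-use-free _ i u n i<n free-high))

  twoCliques-count : ∀ n → TwoCliqueCount n
  twoCliques-count zero    u zero    = refl
  twoCliques-count zero    u (suc t) = refl
  twoCliques-count (suc n) u zero    =
    trans (countMatch-zero (E (suc n)) u) (sym (mUnion-zero (low u (suc n)) (high u (suc n))))
  twoCliques-count (suc n) u (suc t) with bool-cases (elemᵇ n u) | n <? m
  ... | inj₁ used   | _       = step-used n u t (twoCliques-count n) used
  ... | inj₂ unused | yes n<m = step-low n u t (twoCliques-count n) n<m unused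
  ... | inj₂ unused | no  n≮m = step-high n u t (twoCliques-count n) (≮⇒≥ n≮m) unused

-- mBridge a b t = m(K_a ∪ K_b plus one edge between the cliques, t).
mBridge : ℕ → ℕ → ℕ → ℕ
mBridge a b zero    = 1
mBridge a b (suc t) = mUnion a b (suc t) + mUnion (pred a) (pred b) t

-- mPendant N t = m(K_(N-1) plus a pendant edge, t).
mPendant : ℕ → ℕ → ℕ
mPendant N zero    = 1
mPendant N (suc t) = mK (pred N) (suc t) + mK (pred (pred N)) t

mBridge-step : ∀ a b t
  → mBridge a (suc (suc b)) (suc t) ≡ mBridge a (suc b) (suc t) + (mUnion a b t + b * mBridge a b t)
mBridge-step a b zero rewrite mUnion-zero a b | mUnion-zero (pred a) b = arrange (mUnion a (suc b) 1) b
  where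
  arrange : ∀ x b → (x + (1 + b) * 1) + 1 ≡ (x + 1) + (1 + b * 1)
  arrange = solve-∀
mBridge-step a b (suc t) =
  arrange (mUnion a (suc b) (suc (suc t))) (mUnion a b (suc t)) (mUnion (pred a) b (suc t))
          (mUnion (pred a) (pred b) t) b
  where
  arrange : ∀ x y z w b → (x + (1 + b) * y) + (z + b * w) ≡ (x + z) + (y + b * (y + w))
  arrange = solve-∀

mPendant-step : ∀ N t
  → mPendant (3 + N) (suc t) ≡ mPendant (2 + N) (suc t) + (mK N t + N * mPendant (suc N) t)
mPendant-step N zero = arrange (mK (suc N) 1) N
  where
  arrange : ∀ x N → (x + (1 + N) * 1) + 1 ≡ (x + 1) + (1 + N * 1)
  arrange = solve-∀
mPendant-step N (suc t) = arrange (mK (suc N) (suc (suc t))) (mK N (suc t)) (mK (pred N) t) N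
  where
  arrange : ∀ x y w N → (x + (1 + N) * y) + (y + N * w) ≡ (x + y) + (y + N * (y + w))
  arrange = solve-∀

mUnion≤mBridge : ∀ a b t → mUnion a b t ≤ mBridge a b t
mUnion≤mBridge a b zero    = ≤-reflexive (mUnion-zero a b)
mUnion≤mBridge a b (suc t) = m≤m+n _ _

-- Induction on b, using that both sides satisfy the same recursion.
bridge≤pendant : ∀ a' b t → mBridge (2 + a') (suc b) t ≤ mPendant (3 + a' + b) t
bridge≤pendant a' zero    zero    = ≤-refl
bridge≤pendant a' zero    (suc t) rewrite +-identityʳ a' = ≤-reflexive (cong (_+ mK (suc a') t) (+-identityʳ _))
bridge≤pendant a' (suc b) zero    = ≤-refl
bridge≤pendant a' (suc b) (suc t) = begin
  mBridge a (2 + b) (suc t)                              ≡⟨ mBridge-step a b t ⟩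
  mBridge a (suc b) (suc t) + (mUnion a b t + b * mBridge a b t)
    ≤⟨ +-mono-≤ (bridge≤pendant a' b (suc t)) (increment b t) ⟩
  mPendant (2 + N) (suc t) + (mK N t + N * mPendant (suc N) t) ≡⟨ mPendant-step N t ⟨
  mPendant (3 + N) (suc t)                                  ≡⟨ cong (λ x → mPendant (3 + x) (suc t)) (+-suc a' b) ⟨
  mPendant (3 + a' + suc b) (suc t)                         ∎
  where
  open ≤-Reasoning
  a = 2 + a'
  N = suc (a' + b)
  -- the increments of the two recursions compare term by term
  increment : ∀ b t → mUnion a b t + b * mBridge a b t ≤ mK (suc (a' + b)) t + suc (a' + b) * mPendant (2 + a' + b) t
  increment zero t rewrite +-identityʳ a' | *-zeroˡ (mBridge a 0 t) | +-identityʳ (mUnion a 0 t) = clique t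
    where
    clique : ∀ t → mK (2 + a') t ≤ mK (suc a') t + suc a' * mPendant (2 + a') t
    clique zero    = s≤s z≤n
    clique (suc t) = +-monoʳ-≤ (mK (suc a') (suc t)) (*-monoʳ-≤ (suc a') (m≤n+m (mK a' t) _))
  increment (suc b) t = begin
    mUnion a (suc b) t + suc b * mBridge a (suc b) t ≤⟨ +-monoˡ-≤ _ (mUnion≤mBridge a (suc b) t) ⟩
    suc (suc b) * mBridge a (suc b) t                  ≤⟨ *-monoʳ-≤ (2 + b) (bridge≤pendant a' b t) ⟩
    suc (suc b) * mPendant (3 + a' + b) t             ≡⟨ cong (λ x → suc (suc b) * mPendant (2 + x) t) (+-suc a' b) ⟨
    suc (suc b) * mPendant (2 + a' + suc b) t
      ≤⟨ *-monoˡ-≤ _ (s≤s (subst (suc b ≤_) (sym (+-suc a' b)) (s≤s (m≤n+m b a')))) ⟩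
    suc (a' + suc b) * mPendant (2 + a' + suc b) t    ≤⟨ m≤n+m _ (mK (suc (a' + suc b)) t) ⟩
    mK (suc (a' + suc b)) t + suc (a' + suc b) * mPendant (2 + a' + suc b) t ∎

bridge<pendant : ∀ a' b → mBridge (2 + a') (2 + b) 1 < mPendant (4 + a' + b) 1
bridge<pendant a' b = begin-strict
  mBridge a (2 + b) 1                                  ≡⟨ mBridge-step a b 0 ⟩
  mBridge a (suc b) 1 + (mUnion a b 0 + b * mBridge a b 0)
    ≡⟨ cong (λ x → mBridge a (suc b) 1 + (x + b * 1)) (mUnion-zero a b) ⟩
  mBridge a (suc b) 1 + (1 + b * 1)
    <⟨ +-mono-≤-< (bridge≤pendant a' b 1) (s≤s (*-monoˡ-≤ 1 (s≤s (m≤n+m b a')))) ⟩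
  mPendant (2 + N) 1 + (mK N 0 + N * mPendant (suc N) 0) ≡⟨ mPendant-step N 0 ⟨
  mPendant (4 + a' + b) 1                                 ∎
  where
  open ≤-Reasoning
  a = 2 + a'
  N = suc (a' + b)

mBridge≤mPendant : ∀ a b → 2 ≤ a → 1 ≤ b → ∀ t → mBridge a b t ≤ mPendant (a + b) t
mBridge≤mPendant (suc zero) _ (s≤s ()) _ _
mBridge≤mPendant (suc (suc a')) (suc b') _ _ t =
  subst (λ x → mBridge (2 + a') (suc b') t ≤ mPendant (2 + x) t) (sym (+-suc a' b')) (bridge≤pendant a' b' t)

mBridge<mPendant : ∀ a b → 2 ≤ a → 2 ≤ b → mBridge a b 1 < mPendant (a + b) 1
mBridge<mPendant (suc zero)     _              (s≤s ()) _
mBridge<mPendant (suc (suc a')) (suc zero)     _        (s≤s ())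
mBridge<mPendant (suc (suc a')) (suc (suc b')) _        _ =
  subst (λ x → mBridge (2 + a') (2 + b') 1 < mPendant (2 + x) 1) (sym (+-suc a' (suc b')))
    (subst (λ x → mBridge (2 + a') (2 + b') 1 < mPendant (3 + x) 1) (sym (+-suc a' b')) (bridge<pendant a' b'))

adjKkm : ℕ → ℕ → Adjacency
adjKkm m k i j = (j <ᵇ m) ∨ ((not (i <ᵇ m)) ∨ ((i <ᵇ k) ∧ (j ≡ᵇ (m + i))))

adjKstar : ℕ → Adjacency
adjKstar k i j = not (i ≡ᵇ 0) ∨ (j <ᵇ suc k)

Kkm-add-bridge : ∀ n m k → k < m → m + k < n
  → Insertion (k , m + k) (edgesOf (adjKkm m k) n) (edgesOf (adjKkm m (suc k)) n)
Kkm-add-bridge n m k k<m m+k<n =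
  edgesOf-insertion (adjKkm m k) (adjKkm m (suc k)) n (+-monoˡ-≤ k (≤-trans (s≤s z≤n) k<m)) m+k<n agree old new
  where
  agree : ∀ i j → (i ≡ k → j ≢ m + k) → adjKkm m k i j ≡ adjKkm m (suc k) i j
  agree i j not-bridge with i ≟ k
  ... | yes refl rewrite <ᵇ-false {k} {k} ≤-refl | <ᵇ-true {k} {suc k} ≤-refl | ≡ᵇ-false (not-bridge refl) = refl
  ... | no  i≢k  rewrite <ᵇ-suc i≢k = refl
  old : adjKkm m k k (m + k) ≡ false
  old rewrite <ᵇ-false {m + k} {m} (m≤m+n m k) | <ᵇ-true k<m | <ᵇ-false {k} {k} ≤-refl = refl
  new : adjKkm m (suc k) k (m + k) ≡ true
  new rewrite <ᵇ-false {m + k} {m} (m≤m+n m k) | <ᵇ-true k<m | <ᵇ-true {k} {suc k} ≤-refl | ≡ᵇ-refl (m + k) = refl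

Kstar-add-edge : ∀ n k → suc k < n
  → Insertion (0 , suc k) (edgesOf (adjKstar k) n) (edgesOf (adjKstar (suc k)) n)
Kstar-add-edge n k k+1<n = edgesOf-insertion (adjKstar k) (adjKstar (suc k)) n (s≤s z≤n) k+1<n agree old new
  where
  agree : ∀ i j → (i ≡ 0 → j ≢ suc k) → adjKstar k i j ≡ adjKstar (suc k) i j
  agree zero    j not-edge = sym (<ᵇ-suc (not-edge refl))
  agree (suc i) j _        = refl
  old : adjKstar k 0 (suc k) ≡ false
  old = <ᵇ-false {k} {k} ≤-refl
  new : adjKstar (suc k) 0 (suc k) ≡ true
  new = <ᵇ-true {k} {suc k} ≤-refl

Kkm-embeds-complete : ∀ n m k u → Embeds u (edgesOf (adjKkm m k) n) (edgesOf (twoCliques n) n)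
Kkm-embeds-complete n m k u =
  edgesOf-embeds u (adjKkm m k) (twoCliques n) n (λ i j _ j<n _ → inj₁ (cong (_∨ not (i <ᵇ n)) (<ᵇ-true j<n)))

Kkm-embeds-twoCliques : ∀ n m → Embeds [] (edgesOf (adjKkm m 0) n) (edgesOf (twoCliques m) n)
Kkm-embeds-twoCliques n m =
  edgesOf-embeds [] (adjKkm m 0) (twoCliques m) n (λ i j _ _ edge → inj₁ (no-bridges (j <ᵇ m) (not (i <ᵇ m)) edge))
  where
  no-bridges : ∀ a b → a ∨ (b ∨ false) ≡ true → a ∨ b ≡ true
  no-bridges a b edge = trans (cong (a ∨_) (sym (∨-identityʳ b))) edge

complete-embeds-Kstar : ∀ n k u → Embeds (0 ∷ u) (edgesOf (twoCliques n) n) (edgesOf (adjKstar k) n)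
complete-embeds-Kstar n k u = edgesOf-embeds (0 ∷ u) (twoCliques n) (adjKstar k) n star-edge
  where
  star-edge : ∀ i j → i < j → j < n → twoCliques n i j ≡ true
    → adjKstar k i j ≡ true ⊎ Touches (0 ∷ u) (i , j)
  star-edge zero    j _ _ _ = inj₂ refl
  star-edge (suc i) j _ _ _ = inj₁ refl

module FreeCounts (m : ℕ) where
  open TwoCliques m using (low; high; high-empty)

  low-below : ∀ x → x ≤ m → low [] x ≡ x
  low-below zero    _   = refl
  low-below (suc x) x<m rewrite <ᵇ-true x<m | low-below x (<⇒≤ x<m) = +-comm x 1

  low-above : ∀ d → low [] (m + d) ≡ m
  low-above zero    = trans (cong (low []) (+-identityʳ m)) (low-below m ≤-refl)
  low-above (suc d) rewrite +-suc m d | <ᵇ-false {m + d} {m} (m≤m+n m d) | low-above d = +-identityʳ m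

  high-above : ∀ d → high [] (m + d) ≡ d
  high-above zero    = trans (cong (high []) (+-identityʳ m)) (high-empty [] ≤-refl)
  high-above (suc d) rewrite +-suc m d | <ᵇ-false {m + d} {m} (m≤m+n m d) | high-above d = +-comm d 1

  low-all : ∀ n → m ≤ n → low [] n ≡ m
  low-all n m≤n = subst (λ x → low [] x ≡ m) (m+[n∸m]≡n m≤n) (low-above (n ∸ m))

  high-all : ∀ n → m ≤ n → high [] n ≡ n ∸ m
  high-all n m≤n = subst (λ x → high [] x ≡ n ∸ m) (m+[n∸m]≡n m≤n) (high-above (n ∸ m))

  low-pair : ∀ x y → x < m → y < m → x ≢ y → suc (suc (low (x ∷ y ∷ []) m)) ≡ m
  low-pair x y x<m y<m x≢y = begin
    suc (suc (low (x ∷ y ∷ []) m)) ≡⟨ cong suc (countFree-use-free _ x (y ∷ []) m x<m x-free) ⟩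
    suc (low (y ∷ []) m)           ≡⟨ countFree-use-free _ y [] m y<m y-free ⟩
    low [] m                       ≡⟨ low-all m ≤-refl ⟩
    m                              ∎
    where
    open ≡-Reasoning
    x-free : isFree (λ j → j <ᵇ m) (y ∷ []) x ≡ true
    x-free rewrite <ᵇ-true x<m | ≡ᵇ-false x≢y = refl
    y-free : isFree (λ j → j <ᵇ m) [] y ≡ true
    y-free rewrite <ᵇ-true y<m = refl

  low-single : 1 ≤ m → suc (low (0 ∷ []) m) ≡ m
  low-single 1≤m = trans (countFree-use-free _ 0 [] m 1≤m zero-free) (low-all m ≤-refl)
    where
    zero-free : isFree (λ j → j <ᵇ m) [] 0 ≡ true
    zero-free rewrite <ᵇ-true {0} {m} 1≤m = refl

  low-bridge-used : ∀ n → 1 ≤ m → m ≤ n → low (0 ∷ m ∷ []) n ≡ pred m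
  low-bridge-used n 1≤m m≤n = begin
    low (0 ∷ m ∷ []) n ≡⟨ cong pred (countFree-use-free _ 0 (m ∷ []) n (≤-trans 1≤m m≤n) zero-free) ⟩
    pred (low (m ∷ []) n) ≡⟨ cong pred (countFree-use-unfree _ m [] n m-unfree) ⟩
    pred (low [] n)       ≡⟨ cong pred (low-all n m≤n) ⟩
    pred m                ∎
    where
    open ≡-Reasoning
    zero-free : isFree (λ j → j <ᵇ m) (m ∷ []) 0 ≡ true
    zero-free rewrite <ᵇ-true {0} {m} 1≤m | ≡ᵇ-false {0} {m} (λ 0≡m → <-irrefl 0≡m 1≤m) = refl
    m-unfree : isFree (λ j → j <ᵇ m) [] m ≡ false
    m-unfree rewrite <ᵇ-false {m} {m} ≤-refl = refl

  high-bridge-used : ∀ n → 1 ≤ m → m < n → high (0 ∷ m ∷ []) n ≡ pred (n ∸ m)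
  high-bridge-used n 1≤m m<n = begin
    high (0 ∷ m ∷ []) n ≡⟨ countFree-use-unfree _ 0 (m ∷ []) n zero-unfree ⟩
    high (m ∷ []) n     ≡⟨ cong pred (countFree-use-free _ m [] n m<n m-free) ⟩
    pred (high [] n)    ≡⟨ cong pred (high-all n (<⇒≤ m<n)) ⟩
    pred (n ∸ m)        ∎
    where
    open ≡-Reasoning
    zero-unfree : isFree (λ j → not (j <ᵇ m)) (m ∷ []) 0 ≡ false
    zero-unfree rewrite <ᵇ-true {0} {m} 1≤m = refl
    m-free : isFree (λ j → not (j <ᵇ m)) [] m ≡ true
    m-free rewrite <ᵇ-false {m} {m} ≤-refl = refl

complete-count : ∀ n u t → countMatch (edgesOf (twoCliques n) n) u t ≡ mK (TwoCliques.low n u n) t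
complete-count n u t = trans (TwoCliques.twoCliques-count n n u t)
  (cong (λ b → mUnion (TwoCliques.low n u n) b t) (TwoCliques.high-empty n u ≤-refl))

module Comparison (n m : ℕ) (2≤m : 2 ≤ m) (2m≤n : m + m ≤ n) where
  open FreeCounts

  KK : ℕ → List ℕ → ℕ → ℕ
  KK k u t = countMatch (edgesOf (adjKkm m k) n) u t

  KS : ℕ → List ℕ → ℕ → ℕ
  KS k u t = countMatch (edgesOf (adjKstar k) n) u t

  1≤m : 1 ≤ m
  1≤m = ≤-trans (s≤s z≤n) 2≤m

  m+k<n : ∀ k → k < m → m + k < n
  m+k<n k k<m = <-≤-trans (+-monoʳ-< m k<m) 2m≤n

  m<n : m < n
  m<n = subst (_< n) (+-identityʳ m) (m+k<n 0 1≤m)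

  k+1<n : ∀ k → k < m → suc k < n
  k+1<n k k<m = ≤-trans (s≤s k<m) m<n

  2≤n∸m : 2 ≤ n ∸ m
  2≤n∸m = ≤-trans 2≤m (subst (_≤ n ∸ m) (m+n∸m≡n m m) (∸-monoˡ-≤ m 2m≤n))

  -- When the next edge is added, both graphs gain the matchings avoiding its
  -- ends.  For K^k_{n-m,m} these are at most those of K_n minus two vertices,
  -- for K^k_{n-1,1} (where vertex 0 is among the ends) at least those.
  residual-bound : ∀ k → k < m → ∀ t → KK k (k ∷ m + k ∷ []) t ≤ KS k (0 ∷ suc k ∷ []) t
  residual-bound k k<m t = begin
    KK k (k ∷ m + k ∷ []) t                                 ≤⟨ countMatch-embeds (Kkm-embeds-complete n m k _) t ⟩
    countMatch (edgesOf (twoCliques n) n) (k ∷ m + k ∷ []) t ≡⟨ complete-count n _ t ⟩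
    mK (TwoCliques.low n (k ∷ m + k ∷ []) n) t             ≡⟨ cong (λ x → mK x t) same-free ⟩
    mK (TwoCliques.low n (0 ∷ suc k ∷ []) n) t             ≡⟨ complete-count n _ t ⟨
    countMatch (edgesOf (twoCliques n) n) (0 ∷ suc k ∷ []) t ≤⟨ countMatch-embeds (complete-embeds-Kstar n k _) t ⟩
    KS k (0 ∷ suc k ∷ []) t                                 ∎
    where
    open ≤-Reasoning
    k≢m+k : k ≢ m + k
    k≢m+k k≡m+k = <-irrefl k≡m+k (+-monoˡ-≤ k 1≤m)
    same-free : TwoCliques.low n (k ∷ m + k ∷ []) n ≡ TwoCliques.low n (0 ∷ suc k ∷ []) n
    same-free = suc-injective (suc-injective (trans
      (low-pair n k (m + k) (<-trans k<m m<n) (m+k<n k k<m) k≢m+k)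
      (sym (low-pair n 0 (suc k) (≤-trans 1≤m (<⇒≤ m<n)) (k+1<n k k<m) (λ ())))))

  Kkm-1-bound : ∀ t → KK 1 [] (suc t) ≤ mBridge m (n ∸ m) (suc t)
  Kkm-1-bound t = begin
    KK 1 [] (suc t)
      ≡⟨ countMatch-insertion (Kkm-add-bridge n m 0 1≤m (m+k<n 0 1≤m)) [] (suc t) ⟩
    KK 0 [] (suc t) + KK 0 (0 ∷ m + 0 ∷ []) t
      ≤⟨ +-mono-≤ (countMatch-embeds (Kkm-embeds-twoCliques n m) (suc t))
                  (countMatch-embeds (Embeds-⊑ (⊑-nil (0 ∷ m + 0 ∷ [])) (Kkm-embeds-twoCliques n m)) t) ⟩
    countMatch (E n) [] (suc t) + countMatch (E n) (0 ∷ m + 0 ∷ []) t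
      ≡⟨ cong₂ _+_ (twoCliques-count n [] (suc t))
                   (trans (cong (λ x → countMatch (E n) (0 ∷ x ∷ []) t) (+-identityʳ m)) (twoCliques-count n _ t)) ⟩
    mUnion (low [] n) (high [] n) (suc t) + mUnion (low (0 ∷ m ∷ []) n) (high (0 ∷ m ∷ []) n) t
      ≡⟨ cong₂ _+_ (cong₂ (λ a b → mUnion a b (suc t)) (low-all m n (<⇒≤ m<n)) (high-all m n (<⇒≤ m<n)))
                   (cong₂ (λ a b → mUnion a b t) (low-bridge-used m n 1≤m (<⇒≤ m<n))
                                                  (high-bridge-used m n 1≤m m<n)) ⟩
    mBridge m (n ∸ m) (suc t) ∎
    where
    open ≤-Reasoning
    open TwoCliques m using (E; low; high; twoCliques-count)

  -- K^1_{n-1,1} is K_(n-1) plus a pendant edge; only the lower bound is needed.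
  Kstar-1-bound : ∀ t → mPendant n (suc t) ≤ KS 1 [] (suc t)
  Kstar-1-bound t = begin
    mK (pred n) (suc t) + mK (pred (pred n)) t
      ≡⟨ cong₂ (λ x y → mK x (suc t) + mK y t) (sym low-0) (sym low-01) ⟩
    mK (low (0 ∷ []) n) (suc t) + mK (low (0 ∷ 1 ∷ []) n) t
      ≡⟨ cong₂ _+_ (complete-count n (0 ∷ []) (suc t)) (complete-count n (0 ∷ 1 ∷ []) t) ⟨
    countMatch (edgesOf (twoCliques n) n) (0 ∷ []) (suc t) + countMatch (edgesOf (twoCliques n) n) (0 ∷ 1 ∷ []) t
      ≤⟨ +-mono-≤ (countMatch-embeds (complete-embeds-Kstar n 0 []) (suc t))
                  (countMatch-embeds (complete-embeds-Kstar n 0 (1 ∷ [])) t) ⟩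
    KS 0 (0 ∷ []) (suc t) + KS 0 (0 ∷ 1 ∷ []) t
      ≤⟨ +-monoˡ-≤ _ (countMatch-antitone (edgesOf (adjKstar 0) n) [] (0 ∷ []) (⊑-nil (0 ∷ [])) (suc t)) ⟩
    KS 0 [] (suc t) + KS 0 (0 ∷ 1 ∷ []) t
      ≡⟨ countMatch-insertion (Kstar-add-edge n 0 (k+1<n 0 1≤m)) [] (suc t) ⟨
    KS 1 [] (suc t) ∎
    where
    open ≤-Reasoning
    open TwoCliques n using (low)
    low-0 : low (0 ∷ []) n ≡ pred n
    low-0 = cong pred (low-single n (≤-trans 1≤m (<⇒≤ m<n)))
    low-01 : low (0 ∷ 1 ∷ []) n ≡ pred (pred n)
    low-01 = cong (pred ∘ pred) (low-pair n 0 1 (≤-trans 1≤m (<⇒≤ m<n)) (≤-trans 2≤m (<⇒≤ m<n)) (λ ()))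

  Dominated : ℕ → Set
  Dominated k = (∀ t → KK k [] t ≤ KS k [] t) × (KK k [] 1 < KS k [] 1)

  same-empty : ∀ k → KK k [] 0 ≤ KS k [] 0
  same-empty k = ≤-reflexive (trans (countMatch-zero (edgesOf (adjKkm m k) n) [])
                                   (sym (countMatch-zero (edgesOf (adjKstar k) n) [])))

  dominated-1 : Dominated 1
  dominated-1 = bounded , strict
    where
    pendant : ∀ t → mBridge m (n ∸ m) t ≤ mPendant n t
    pendant t = subst (λ x → mBridge m (n ∸ m) t ≤ mPendant x t) (m+[n∸m]≡n (<⇒≤ m<n))
      (mBridge≤mPendant m (n ∸ m) 2≤m (≤-trans (s≤s z≤n) 2≤n∸m) t)
    bounded : ∀ t → KK 1 [] t ≤ KS 1 [] t
    bounded zero    = same-empty 1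
    bounded (suc t) = ≤-trans (Kkm-1-bound t) (≤-trans (pendant (suc t)) (Kstar-1-bound t))
    strict : KK 1 [] 1 < KS 1 [] 1
    strict = ≤-<-trans (Kkm-1-bound 0) (<-≤-trans
      (subst (λ x → mBridge m (n ∸ m) 1 < mPendant x 1) (m+[n∸m]≡n (<⇒≤ m<n))
             (mBridge<mPendant m (n ∸ m) 2≤m 2≤n∸m))
      (Kstar-1-bound 0))

  dominated-step : ∀ k → k < m → Dominated k → Dominated (suc k)
  dominated-step k k<m (bounded , strict) = bounded′ , strict′
    where
    add-edges : ∀ t → KK (suc k) [] (suc t) ≡ KK k [] (suc t) + KK k (k ∷ m + k ∷ []) t
                    × KS (suc k) [] (suc t) ≡ KS k [] (suc t) + KS k (0 ∷ suc k ∷ []) t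
    add-edges t = countMatch-insertion (Kkm-add-bridge n m k k<m (m+k<n k k<m)) [] (suc t)
                , countMatch-insertion (Kstar-add-edge n k (k+1<n k k<m)) [] (suc t)
    bounded′ : ∀ t → KK (suc k) [] t ≤ KS (suc k) [] t
    bounded′ zero    = same-empty (suc k)
    bounded′ (suc t) = subst₂ _≤_ (sym (proj₁ (add-edges t))) (sym (proj₂ (add-edges t)))
      (+-mono-≤ (bounded (suc t)) (residual-bound k k<m t))
    strict′ : KK (suc k) [] 1 < KS (suc k) [] 1
    strict′ = subst₂ _<_ (sym (proj₁ (add-edges 0))) (sym (proj₂ (add-edges 0)))
      (+-mono-<-≤ strict (residual-bound k k<m 0))

  dominated : ∀ k → 1 ≤ k → k ≤ m → Dominated k
  dominated (suc zero)    _ _     = dominated-1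
  dominated (suc (suc k)) _ k+2≤m = dominated-step (suc k) k+2≤m (dominated (suc k) (s≤s z≤n) (<⇒≤ k+2≤m))

corollary2p9 : (n k m : ℕ) → 2 ≤ n → 1 ≤ k → k ≤ m → 2 ≤ m → m ≤ n / 2 →
    Kkm n m k ≺ Kstar n k
corollary2p9 n k m _ 1≤k k≤m 2≤m m≤n/2 =
  (λ t _ → bounded t) , (1 , 1≤n/2 , strict)
  where
  2m≤n : m + m ≤ n
  2m≤n = subst (_≤ n) (trans (*-comm m 2) (cong (m +_) (+-identityʳ m)))
                (≤-trans (*-monoˡ-≤ 2 m≤n/2) (m/n*n≤m n 2))
  1≤n/2 : 1 ≤ n / 2
  1≤n/2 = ≤-trans (≤-trans (s≤s z≤n) 2≤m) m≤n/2
  open Comparison n m 2≤m 2m≤n using (dominated)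
  bounded = proj₁ (dominated k 1≤k k≤m)
  strict  = proj₂ (dominated k 1≤k k≤m)
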